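{- Let $0<\tau\le1$. Let $U_1,U_2\subseteq V$ with $s\in U_1$ and $s\in U_2$. If both $(U_1,V\setminus U_1)$ and $(U_2,V\setminus U_2)$ are $\tau$-narrow, then $U_1\subseteq U_2$ or $U_2\subseteq U_1$.
   Context: $G=(V,E)$ is a complete graph with metric cost $c:E\to\mathbb{R}_+$ and distinct endpoints $s,t\in V$; $x^*$ is an optimal solution to the path-variant Held-Karp relaxation: minimize $c(x)=\sum_ec_ex_e$ subject to $x(\delta(S))\ge1$ for all $S\subsetneq V$ with $|S\cap\{s,t\}|=1$; $x(\delta(S))\ge2$ for all nonempty $S\subsetneq V$ with $|S\cap\{s,t\}|\ne1$; $x(\delta(\{s\}))=x(\delta(\{t\}))=1$; $x(\delta(\{v\}))=2$ for $v\in V\setminus\{s,t\}$; $x\ge0$. Here $\delta(S)$ is the set of edges with exactly one endpoint in $S$ and $x(F)=\sum_{e\in F}x_e$. For nonempty $U\subsetneq V$, the cut $(U,V\setminus U)$ is an $s$-$t$ cut if $|U\cap\{s,t\}|=1$; for $0<\tau\le1$, an $s$-$t$ cut $(U,V\setminus U)$ is called $\tau$-narrow if $x^*(\delta(U))<1+\tau$.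
   Formalization: The metric cost c, the optimal Held–Karp solution x* and the parameter τ are rational rather than real, and optimality of x* is taken over rational feasible points only. -}

module Defs where

open import Data.Nat as ℕ using (ℕ; _<ᵇ_)
open import Data.Bool using (Bool; true; false; if_then_else_; _xor_)
open import Data.Fin using (Fin; toℕ)
open import Data.Fin.Subset using (Subset; _∈_; _∉_)
open import Data.List using (List; []; _∷_; concatMap; map; foldr; filter)
import Data.List as L
open import Data.Vec using (lookup)
open import Data.Product using (∃)
open import Data.Rational using (ℚ; 0ℚ; 1ℚ; _+_; _*_; _≤_; _<_)
open import Relation.Binary.PropositionalEquality using (_≡_; _≢_)

-- Vertex set V = Fin n.  Edge weights/costs are functions Fin n → Fin n → ℚ;
-- the edge {u,v} (u ≠ v) is represented by the ordered pair with toℕ u < toℕ v.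

allFin : (n : ℕ) → List (Fin n)
allFin n = L.allFin n

sumℚ : List ℚ → ℚ
sumℚ = foldr _+_ 0ℚ

edgeVals : {n : ℕ} → (Fin n → Fin n → Bool) → (Fin n → Fin n → ℚ) → List ℚ
edgeVals {n} keep f =
  concatMap (λ u → concatMap (λ v →
     if (toℕ u <ᵇ toℕ v) then (if keep u v then f u v ∷ [] else []) else [])
     (allFin n)) (allFin n)

edgeSum : {n : ℕ} → (Fin n → Fin n → Bool) → (Fin n → Fin n → ℚ) → ℚ
edgeSum keep f = sumℚ (edgeVals keep f)

inS : {n : ℕ} → Subset n → Fin n → Bool
inS S u = lookup S u

cutValue : {n : ℕ} → (Fin n → Fin n → ℚ) → Subset n → ℚ
cutValue x S = edgeSum (λ u v → inS S u xor inS S v) x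

cost : {n : ℕ} → (Fin n → Fin n → ℚ) → (Fin n → Fin n → ℚ) → ℚ
cost c x = edgeSum (λ _ _ → true) (λ u v → c u v * x u v)

singleton : {n : ℕ} → Fin n → Subset n
singleton = Data.Fin.Subset.⁅_⁆

twoℚ : ℚ
twoℚ = 1ℚ + 1ℚ

countST : {n : ℕ} → Fin n → Fin n → Subset n → ℕ
countST s t S = (if inS S s then 1 else 0) ℕ.+ (if inS S t then 1 else 0)

NonemptyProper : {n : ℕ} → Subset n → Set
NonemptyProper S = ∃ (λ u → u ∈ S) Data.Product.× ∃ (λ v → v ∉ S)

Metric : {n : ℕ} → (Fin n → Fin n → ℚ) → Set
Metric {n} c =
  ((u v : Fin n) → 0ℚ ≤ c u v) Data.Product.×
  ((u v : Fin n) → c u v ≡ c v u) Data.Product.×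
  ((u v w : Fin n) → c u w ≤ c u v + c v w)

Feasible : {n : ℕ} → Fin n → Fin n → (Fin n → Fin n → ℚ) → Set
Feasible {n} s t x =
  ((u v : Fin n) → toℕ u ℕ.< toℕ v → 0ℚ ≤ x u v) Data.Product.×
  ((S : Subset n) → NonemptyProper S → countST s t S ≡ 1 → 1ℚ ≤ cutValue x S) Data.Product.×
  ((S : Subset n) → NonemptyProper S → countST s t S ≢ 1 → twoℚ ≤ cutValue x S) Data.Product.×
  (cutValue x (singleton s) ≡ 1ℚ) Data.Product.×
  (cutValue x (singleton t) ≡ 1ℚ) Data.Product.×
  ((v : Fin n) → v ≢ s → v ≢ t → cutValue x (singleton v) ≡ twoℚ)

Optimal : {n : ℕ} → Fin n → Fin n → (Fin n → Fin n → ℚ) → (Fin n → Fin n → ℚ) → Set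
Optimal {n} s t c x =
  Feasible s t x Data.Product.×
  ((y : Fin n → Fin n → ℚ) → Feasible s t y → cost c x ≤ cost c y)

IsSTCut : {n : ℕ} → Fin n → Fin n → Subset n → Set
IsSTCut s t U = countST s t U ≡ 1

Narrow : {n : ℕ} → Fin n → Fin n → (Fin n → Fin n → ℚ) → ℚ → Subset n → Set
Narrow s t x τ U = IsSTCut s t U Data.Product.× (cutValue x U < 1ℚ + τ)

{-# OPTIONS --safe #-}
-- If both differences U₁ ∖ U₂ and U₂ ∖ U₁ were nonempty, they would contain neither
-- s (which lies in both sets) nor t (which lies in neither), so each of their cuts
-- has x-value at least 2.  Posimodularity of the cut function then gives
-- 4 ≤ x(δ(U₁ ∖ U₂)) + x(δ(U₂ ∖ U₁)) ≤ x(δ(U₁)) + x(δ(U₂)) < 2 + 2τ ≤ 4.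
module Submission where

open import Defs
open import Data.Nat using (ℕ)
import Data.Nat as N
open import Data.Fin using (Fin)
open import Data.Fin.Subset using (Subset; _∈_; _⊆_)
open import Data.Sum using (_⊎_)
open import Data.Rational using (ℚ; 0ℚ; 1ℚ; _≤_; _<_)
open import Relation.Binary.PropositionalEquality using (_≢_)

open import Algebra.Bundles using (CommutativeMonoid)
open import Data.Bool using (Bool; true; false; if_then_else_; _xor_; _∧_; not; T; f≤t; b≤b)
  renaming (_≤_ to _≤ᵇ_)
open import Data.Bool.Properties using (¬-not; ∧-zeroʳ; ∧-identityʳ)
open import Data.Empty using (⊥-elim)
open import Data.Fin using (toℕ; zero; suc)
open import Data.Fin.Subset using (inside; outside; _∉_; _─_; Nonempty)
open import Data.Fin.Subset.Properties using (_⊆?_; _∈?_; nonempty?; p─q⊆p; x∈p∧x∉q⇒x∈p─q)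
open import Data.List using (List; []; _∷_; _++_; concatMap)
open import Data.Nat.Properties using (<ᵇ⇒<; 0≢1+n)
open import Data.Product using (_×_; _,_)
open import Data.Rational using (_+_)
open import Data.Rational.Properties
  using (≤-refl; +-comm; +-assoc; +-identityˡ; +-identityʳ; +-mono-≤; +-mono-<; +-monoʳ-≤; <-irrefl;
         +-0-commutativeMonoid; module ≤-Reasoning)
open import Algebra.Properties.CommutativeSemigroup
  (CommutativeMonoid.commutativeSemigroup +-0-commutativeMonoid) using (interchange)
open import Data.Sum using (inj₁; inj₂)
open import Data.Unit using (tt)
open import Data.Vec using (_∷_; lookup; here; there)
open import Data.Vec.Properties using (lookup⇒[]=; []=⇒lookup)
open import Function using (_∘_)
open import Relation.Nullary using (yes; no; ¬_)
open import Relation.Binary.PropositionalEquality using (_≡_; refl; sym; trans; cong; cong₂; subst)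

sumℚ-++ : (xs ys : List ℚ) → sumℚ (xs ++ ys) ≡ sumℚ xs + sumℚ ys
sumℚ-++ []       ys = sym (+-identityˡ (sumℚ ys))
sumℚ-++ (a ∷ xs) ys = trans (cong (a +_) (sumℚ-++ xs ys)) (sym (+-assoc a (sumℚ xs) (sumℚ ys)))

sumℚ-concatMap-mono₂ : {A : Set} (f g h k : A → List ℚ) (l : List A) →
  (∀ a → sumℚ (f a) + sumℚ (g a) ≤ sumℚ (h a) + sumℚ (k a)) →
  sumℚ (concatMap f l) + sumℚ (concatMap g l) ≤ sumℚ (concatMap h l) + sumℚ (concatMap k l)
sumℚ-concatMap-mono₂ f g h k []      _   = ≤-refl
sumℚ-concatMap-mono₂ f g h k (a ∷ l) f+g≤h+k = begin
  sumℚ (f a ++ concatMap f l) + sumℚ (g a ++ concatMap g l)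
    ≡⟨ cong₂ _+_ (sumℚ-++ (f a) _) (sumℚ-++ (g a) _) ⟩
  (sumℚ (f a) + F) + (sumℚ (g a) + G)
    ≡⟨ interchange (sumℚ (f a)) F (sumℚ (g a)) G ⟩
  (sumℚ (f a) + sumℚ (g a)) + (F + G)
    ≤⟨ +-mono-≤ (f+g≤h+k a) (sumℚ-concatMap-mono₂ f g h k l f+g≤h+k) ⟩
  (sumℚ (h a) + sumℚ (k a)) + (H + K)
    ≡⟨ interchange (sumℚ (h a)) (sumℚ (k a)) H K ⟩
  (sumℚ (h a) + H) + (sumℚ (k a) + K)
    ≡⟨ cong₂ _+_ (sumℚ-++ (h a) _) (sumℚ-++ (k a) _) ⟨
  sumℚ (h a ++ concatMap h l) + sumℚ (k a ++ concatMap k l) ∎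
  where
  open ≤-Reasoning
  F G H K : ℚ
  F = sumℚ (concatMap f l); G = sumℚ (concatMap g l)
  H = sumℚ (concatMap h l); K = sumℚ (concatMap k l)

-- Ensures p + q ≤ r + s when the booleans are read as 0/1-weights.
Dominated : Bool → Bool → Bool → Bool → Set
Dominated p q r s = (p ≤ᵇ r × q ≤ᵇ s) ⊎ (p ≤ᵇ s × q ≤ᵇ r)

-- An edge with endpoint memberships (a , b) and (a′ , b′) in A and B is cut at most
-- as often by A ∖ B and B ∖ A together as by A and B together.
xor-─-dominated : ∀ a b a′ b′ →
  Dominated ((a ∧ not b) xor (a′ ∧ not b′)) ((b ∧ not a) xor (b′ ∧ not a′)) (a xor a′) (b xor b′)
xor-─-dominated false false false false = inj₁ (b≤b , b≤b)
xor-─-dominated false false false true  = inj₁ (b≤b , b≤b)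
xor-─-dominated false false true  false = inj₁ (b≤b , b≤b)
xor-─-dominated false false true  true  = inj₁ (f≤t , f≤t)
xor-─-dominated false true  false false = inj₁ (b≤b , b≤b)
xor-─-dominated false true  false true  = inj₁ (b≤b , b≤b)
xor-─-dominated false true  true  false = inj₁ (b≤b , b≤b)
xor-─-dominated false true  true  true  = inj₂ (b≤b , b≤b)
xor-─-dominated true  false false false = inj₁ (b≤b , b≤b)
xor-─-dominated true  false false true  = inj₁ (b≤b , b≤b)
xor-─-dominated true  false true  false = inj₁ (b≤b , b≤b)
xor-─-dominated true  false true  true  = inj₂ (b≤b , b≤b)
xor-─-dominated true  true  false false = inj₁ (f≤t , f≤t)
xor-─-dominated true  true  false true  = inj₂ (b≤b , b≤b)
xor-─-dominated true  true  true  false = inj₂ (b≤b , b≤b)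
xor-─-dominated true  true  true  true  = inj₁ (b≤b , b≤b)

weightIf : ℚ → Bool → ℚ
weightIf w b = sumℚ (if b then w ∷ [] else [])

weightIf-mono : ∀ {w p q} → 0ℚ ≤ w → p ≤ᵇ q → weightIf w p ≤ weightIf w q
weightIf-mono {w} 0≤w f≤t = subst (0ℚ ≤_) (sym (+-identityʳ w)) 0≤w
weightIf-mono     _   b≤b = ≤-refl

weightIf-mono₂ : ∀ {w p q r s} → 0ℚ ≤ w → Dominated p q r s →
  weightIf w p + weightIf w q ≤ weightIf w r + weightIf w s
weightIf-mono₂ 0≤w (inj₁ (p≤r , q≤s)) = +-mono-≤ (weightIf-mono 0≤w p≤r) (weightIf-mono 0≤w q≤s)
weightIf-mono₂ {w} {p} {q} {r} {s} 0≤w (inj₂ (p≤s , q≤r)) = begin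
  weightIf w p + weightIf w q ≤⟨ +-mono-≤ (weightIf-mono 0≤w p≤s) (weightIf-mono 0≤w q≤r) ⟩
  weightIf w s + weightIf w r ≡⟨ +-comm (weightIf w s) (weightIf w r) ⟩
  weightIf w r + weightIf w s ∎
  where open ≤-Reasoning

guardedWeightIf-mono₂ : ∀ {w p q r s} (g : Bool) → (T g → 0ℚ ≤ w) → Dominated p q r s →
  sumℚ (if g then (if p then w ∷ [] else []) else []) + sumℚ (if g then (if q then w ∷ [] else []) else [])
  ≤ sumℚ (if g then (if r then w ∷ [] else []) else []) + sumℚ (if g then (if s then w ∷ [] else []) else [])
guardedWeightIf-mono₂ false _   _   = ≤-refl
guardedWeightIf-mono₂ true  0≤w dom = weightIf-mono₂ (0≤w tt) dom

edgeSum-mono₂ : {n : ℕ} (x : Fin n → Fin n → ℚ) → ((u v : Fin n) → toℕ u N.< toℕ v → 0ℚ ≤ x u v) →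
  (k₁ k₂ k₃ k₄ : Fin n → Fin n → Bool) → ((u v : Fin n) → Dominated (k₁ u v) (k₂ u v) (k₃ u v) (k₄ u v)) →
  edgeSum k₁ x + edgeSum k₂ x ≤ edgeSum k₃ x + edgeSum k₄ x
edgeSum-mono₂ {n} x x≥0 k₁ k₂ k₃ k₄ dom =
  sumℚ-concatMap-mono₂ _ _ _ _ (allFin n) λ u →
  sumℚ-concatMap-mono₂ _ _ _ _ (allFin n) λ v →
  guardedWeightIf-mono₂ (toℕ u N.<ᵇ toℕ v) (x≥0 u v ∘ <ᵇ⇒< (toℕ u) (toℕ v)) (dom u v)

lookup-─ : {n : ℕ} (p q : Subset n) (i : Fin n) → lookup (p ─ q) i ≡ lookup p i ∧ not (lookup q i)
lookup-─ (a ∷ p) (inside  ∷ q) zero    = sym (∧-zeroʳ a)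
lookup-─ (a ∷ p) (outside ∷ q) zero    = sym (∧-identityʳ a)
lookup-─ (_ ∷ p) (_       ∷ q) (suc i) = lookup-─ p q i

cutValue-posimodular : {n : ℕ} (x : Fin n → Fin n → ℚ) → ((u v : Fin n) → toℕ u N.< toℕ v → 0ℚ ≤ x u v) →
  (A B : Subset n) → cutValue x (A ─ B) + cutValue x (B ─ A) ≤ cutValue x A + cutValue x B
cutValue-posimodular x x≥0 A B = edgeSum-mono₂ x x≥0 _ _ _ _ dominated
  where
  dominated : ∀ u v → Dominated (lookup (A ─ B) u xor lookup (A ─ B) v) (lookup (B ─ A) u xor lookup (B ─ A) v)
                                (lookup A u xor lookup A v) (lookup B u xor lookup B v)
  dominated u v rewrite lookup-─ A B u | lookup-─ A B v | lookup-─ B A u | lookup-─ B A v =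
    xor-─-dominated (lookup A u) (lookup B u) (lookup A v) (lookup B v)

∉⇒lookup≡false : {n : ℕ} {p : Subset n} {i : Fin n} → i ∉ p → lookup p i ≡ false
∉⇒lookup≡false {p = p} {i} i∉p = ¬-not (i∉p ∘ lookup⇒[]= i p)

x∈q⇒x∉p─q : {n : ℕ} {p q : Subset n} {x : Fin n} → x ∈ q → x ∉ p ─ q
x∈q⇒x∉p─q {p = _ ∷ _} here        ()
x∈q⇒x∉p─q {p = _ ∷ _} (there x∈q) (there x∈p─q) = x∈q⇒x∉p─q x∈q x∈p─q

x∉p⇒x∉p─q : {n : ℕ} {p q : Subset n} {x : Fin n} → x ∉ p → x ∉ p ─ q
x∉p⇒x∉p─q {p = p} {q} x∉p = x∉p ∘ p─q⊆p p q

⊈⇒Nonempty─ : {n : ℕ} {p q : Subset n} → ¬ p ⊆ q → Nonempty (p ─ q)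
⊈⇒Nonempty─ {p = p} {q} p⊈q with nonempty? (p ─ q)
... | yes p─q≢∅ = p─q≢∅
... | no  p─q≡∅ = ⊥-elim (p⊈q p⊆q)
  where
  p⊆q : p ⊆ q
  p⊆q {x} x∈p with x ∈? q
  ... | yes x∈q = x∈q
  ... | no  x∉q = ⊥-elim (p─q≡∅ (x , x∈p∧x∉q⇒x∈p─q x∈p x∉q))

st-cut-separates : {n : ℕ} {s t : Fin n} {U : Subset n} → IsSTCut s t U → s ∈ U → t ∉ U
st-cut-separates {s = s} {t} {U} cut s∈U t∈U
  with lookup U s | []=⇒lookup s∈U | lookup U t | []=⇒lookup t∈U | cut
... | true | refl | true | refl | ()

countST-outside : {n : ℕ} {s t : Fin n} {D : Subset n} → s ∉ D → t ∉ D → countST s t D ≡ 0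
countST-outside s∉D t∉D rewrite ∉⇒lookup≡false s∉D | ∉⇒lookup≡false t∉D = refl

Feasible⇒avoiding-cut≥2 : {n : ℕ} {s t : Fin n} {x : Fin n → Fin n → ℚ} {D : Subset n} →
  Feasible s t x → Nonempty D → s ∉ D → t ∉ D → twoℚ ≤ cutValue x D
Feasible⇒avoiding-cut≥2 {D = D} (_ , _ , cut≥2 , _) D≢∅ s∉D t∉D =
  cut≥2 D (D≢∅ , (_ , s∉D)) (0≢1+n ∘ trans (sym (countST-outside s∉D t∉D)))

Feasible⇒crossing-cuts≥4 : {n : ℕ} {s t : Fin n} {x : Fin n → Fin n → ℚ} {A B : Subset n} →
  Feasible s t x → s ∈ A → s ∈ B → t ∉ A → t ∉ B → ¬ A ⊆ B → ¬ B ⊆ A →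
  twoℚ + twoℚ ≤ cutValue x A + cutValue x B
Feasible⇒crossing-cuts≥4 {s = s} {t} {x} {A} {B} feas@(x≥0 , _) s∈A s∈B t∉A t∉B A⊈B B⊈A = begin
  twoℚ + twoℚ                           ≤⟨ +-mono-≤ (difference-cut≥2 s∈B t∉A A⊈B) (difference-cut≥2 s∈A t∉B B⊈A) ⟩
  cutValue x (A ─ B) + cutValue x (B ─ A) ≤⟨ cutValue-posimodular x x≥0 A B ⟩
  cutValue x A + cutValue x B           ∎
  where
  open ≤-Reasoning
  difference-cut≥2 : ∀ {P Q} → s ∈ Q → t ∉ P → ¬ P ⊆ Q → twoℚ ≤ cutValue x (P ─ Q)
  difference-cut≥2 s∈Q t∉P P⊈Q = Feasible⇒avoiding-cut≥2 feas (⊈⇒Nonempty─ P⊈Q) (x∈q⇒x∉p─q s∈Q) (x∉p⇒x∉p─q t∉P)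

lemma8 : (n : ℕ) (s t : Fin n) → s ≢ t →
    (c x : Fin n → Fin n → ℚ) → Metric c → Optimal s t c x →
    (τ : ℚ) → 0ℚ < τ → τ ≤ 1ℚ →
    (U₁ U₂ : Subset n) → s ∈ U₁ → s ∈ U₂ →
    Narrow s t x τ U₁ → Narrow s t x τ U₂ →
    (U₁ ⊆ U₂) ⊎ (U₂ ⊆ U₁)
lemma8 _ _ t _ _ x _ (feas , _) τ _ τ≤1 U₁ U₂ s∈U₁ s∈U₂ (cut₁ , narrow₁) (cut₂ , narrow₂)
  with U₁ ⊆? U₂ | U₂ ⊆? U₁
... | yes U₁⊆U₂ | _         = inj₁ U₁⊆U₂
... | no  _     | yes U₂⊆U₁ = inj₂ U₂⊆U₁
... | no  U₁⊈U₂ | no  U₂⊈U₁ = ⊥-elim (<-irrefl refl (begin-strict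
  twoℚ + twoℚ                   ≤⟨ Feasible⇒crossing-cuts≥4 feas s∈U₁ s∈U₂ t∉U₁ t∉U₂ U₁⊈U₂ U₂⊈U₁ ⟩
  cutValue x U₁ + cutValue x U₂ <⟨ +-mono-< narrow₁ narrow₂ ⟩
  (1ℚ + τ) + (1ℚ + τ)           ≤⟨ +-mono-≤ 1+τ≤2 1+τ≤2 ⟩
  twoℚ + twoℚ                   ∎))
  where
  open ≤-Reasoning
  t∉U₁ : t ∉ U₁
  t∉U₁ = st-cut-separates cut₁ s∈U₁
  t∉U₂ : t ∉ U₂
  t∉U₂ = st-cut-separates cut₂ s∈U₂
  1+τ≤2 : 1ℚ + τ ≤ twoℚ
  1+τ≤2 = +-monoʳ-≤ 1ℚ τ≤1
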